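{- Let $n\ge 1$ and $\lambda=(n,n)$. Then for every integer $i\ge 0$, the number of inverted Young tableaux of shape $(n,n)$ with exactly $i$ inversions is $$|S_i(n,n)|=\left(\sum_{k_1+\dots+k_i=n}C_{k_1}C_{k_2}\cdots C_{k_i}\right)+\left(\sum_{l_1+\dots+l_{i+1}=n}C_{l_1}C_{l_2}\cdots C_{l_{i+1}}\right),$$ where $C_j=\frac{1}{j+1}\binom{2j}{j}$ is the $j$-th Catalan number and the two sums run over all ordered compositions of $n$ into exactly $i$ positive parts and exactly $i+1$ positive parts, respectively (an empty sum being $0$).
   Context: A tableau of shape $(n,n)$ is a bijective filling of a $2\times n$ array of boxes with $1,\dots,2n$; it is row-standard if entries increase left to right along each row. For a row-standard tableau $\tau$, a pair of entries $i<j$ in the same column is an inversion if either (1) $i$ or $j$ has no entry immediately to its right and $i$ lies below $j$, or (2) $i$ is immediately followed on its right by $i'$, $j$ is immediately followed on its right by $j'$, and $i'>j'$. $S_i(n,n)$ denotes the set of row-standard tableaux of shape $(n,n)$ with exactly $i$ inversions. -}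

module Defs where

open import Data.Nat using (ℕ; zero; suc; _+_; _*_; _∸_; _<ᵇ_; _≡ᵇ_)
open import Data.Nat.DivMod using (_/_)
open import Data.Nat.Combinatorics using (_C_)
open import Data.Bool using (Bool; true; false; _∧_; _∨_; not; if_then_else_)
open import Data.Fin using (Fin; toℕ)
open import Data.List using (List; []; _∷_; [_]; map; concatMap; filterᵇ; length; upTo; _++_)
open import Data.Nat.ListAction using (sum; product)
open import Data.Bool.ListAction using (any)
open import Data.Vec as V using (Vec; toList)
open import Data.Fin using (Fin)
open import Data.List using (allFin)

catalan : ℕ → ℕ
catalan j = ((2 * j) C j) / suc j

compositions : ℕ → ℕ → List (List ℕ)
compositions zero zero = [ [] ]
compositions zero (suc n) = []
compositions (suc p) n =
  concatMap (λ k → map (suc k ∷_) (compositions p (n ∸ suc k))) (upTo n)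

catalanCompSum : ℕ → ℕ → ℕ
catalanCompSum p n = sum (map (λ ks → product (map catalan ks)) (compositions p n))

-- Tableaux of shape (n,n): a top row and a bottom row, each a vector of
-- n entries from Fin (2n) (entry e : Fin (2n) stands for the number toℕ e + 1).

record Tableau (n : ℕ) : Set where
  constructor tab
  field
    top    : Vec (Fin (2 * n)) n
    bottom : Vec (Fin (2 * n)) n
open Tableau public

allVecs : (k m : ℕ) → List (Vec (Fin m) k)
allVecs zero m = [ V.[] ]
allVecs (suc k) m = concatMap (λ x → map (x V.∷_) (allVecs k m)) (allFin m)

allFillings : (n : ℕ) → List (Tableau n)
allFillings n = concatMap (λ t → map (tab t) (allVecs n (2 * n))) (allVecs n (2 * n))

increasing : List ℕ → Bool
increasing [] = true
increasing (x ∷ []) = true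
increasing (x ∷ y ∷ xs) = (x <ᵇ y) ∧ increasing (y ∷ xs)

distinct : List ℕ → Bool
distinct [] = true
distinct (x ∷ xs) = not (any (λ y → x ≡ᵇ y) xs) ∧ distinct xs


topℕ bottomℕ : ∀ {n} → Tableau n → List ℕ
topℕ τ = map toℕ (toList (top τ))
bottomℕ τ = map toℕ (toList (bottom τ))

-- bijective filling (2n distinct entries from a 2n-element set) and
-- row-standard (increasing along each row)
isRowStandardTableau : ∀ {n} → Tableau n → Bool
isRowStandardTableau τ =
  distinct (topℕ τ ++ bottomℕ τ) ∧ increasing (topℕ τ) ∧ increasing (bottomℕ τ)

b2n : Bool → ℕ
b2n true = 1
b2n false = 0

-- Column with no entry to its right (last column): inversion iff the
-- smaller entry lies below, i.e. bottom < top.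
-- Other columns (x top, y bottom, x' y' their right neighbours): with
-- i = min(x,y), j = max(x,y), inversion iff i' > j', i.e.
--   (x < y and x' > y') or (y < x and y' > x').
inversionsRows : List ℕ → List ℕ → ℕ
inversionsRows (x ∷ []) (y ∷ []) = b2n (y <ᵇ x)
inversionsRows (x ∷ x' ∷ xs) (y ∷ y' ∷ ys) =
  b2n (((x <ᵇ y) ∧ (y' <ᵇ x')) ∨ ((y <ᵇ x) ∧ (x' <ᵇ y')))
  + inversionsRows (x' ∷ xs) (y' ∷ ys)
inversionsRows _ _ = 0

inversions : ∀ {n} → Tableau n → ℕ
inversions τ = inversionsRows (topℕ τ) (bottomℕ τ)

S-card : (i n : ℕ) → ℕ
S-card i n = length (filterᵇ (λ τ → isRowStandardTableau τ ∧ (inversions τ ≡ᵇ i)) (allFillings n))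

-- Read a row-standard tableau of shape (n, n) as the word w whose j-th letter says
-- whether j lies in the top row: this identifies the tableaux with the lattice paths
-- with n up-steps (top) and n down-steps (bottom).  Reading w from left to right,
-- a column is completed exactly at a step towards height 0, and its top entry is the
-- smaller one iff the path is above 0 at that moment.  The inversions are therefore
-- the changes of side between consecutive completed columns, plus one if the last
-- column has its smaller entry at the bottom.  A recursion on the remaining letters, the current height and the
-- last side shows that ballot (2i) (n − i) paths have i inversions, where ballot h a
-- counts the nonnegative paths from height h down to 0 with a up-steps.  On the other
-- side, a sequence of p + 1 nonempty Dyck paths of total semilength x + 1 is a
-- nonnegative path from height 2p + 1, so both composition sums are ballot numbers as
-- well, and they add up to ballot (2i) (n − i) by the ballot recursion.
module Submission where

open import Data.Nat
open import Data.Nat.Properties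
open import Algebra.Properties.CommutativeSemigroup +-commutativeSemigroup using () renaming (interchange to +-interchange; x∙yz≈y∙xz to x+[y+z]≡y+[x+z])
open import Data.Nat.Combinatorics using (_C_; nCk≡nC[n∸k]; nC1≡n) renaming (nCk+nC[k+1]≡[n+1]C[k+1] to pascal)
open import Data.Nat.DivMod using (_/_; m*n/n≡m)
open import Data.Nat.Tactic.RingSolver using (solve-∀)
open import Data.Nat.ListAction using (sum; product)
open import Data.Nat.ListAction.Properties using (sum-++)
open import Data.Bool using (Bool; true; false; not; _∧_; _∨_; if_then_else_; _xor_; T; T?)
open import Data.Bool.Properties using (if-float; T-∧) renaming (_≟_ to _≟ᴮ_)
open import Data.Bool.ListAction using (any)
open import Data.Maybe using (Maybe; just; nothing)
open import Data.Product using (_×_; _,_; proj₁; proj₂; map₁; map₂; ∃)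
open import Data.Sum using (inj₁; inj₂)
open import Data.Fin using (Fin; toℕ; fromℕ<)
open import Data.Fin.Properties using (toℕ<n; toℕ-injective; toℕ-fromℕ<)
open import Data.Vec as V using (Vec; toList)
open import Data.Vec.Properties using (length-toList; toList-injective; ∷-injective)
open import Data.Vec.Relation.Binary.Equality.Cast using (cast-is-id)
open import Data.List using (List; []; _∷_; [_]; _∷ʳ_; map; concatMap; upTo; applyUpTo; _++_; length; filterᵇ; zipWith; cartesianProductWith; allFin)
open import Data.List.Properties using (map-++; map-cong; map-upTo; filter-++; length-++; ++-identityʳ; ++-assoc; ∷ʳ-++; ∷-injectiveʳ; length-map; map-injective)
open import Data.List.Relation.Unary.All as All using (All; []; _∷_)
open import Data.List.Relation.Unary.All.Properties using (∷ʳ⁺; map⁺)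
open import Data.List.Relation.Unary.AllPairs using ([]; _∷_)
open import Data.List.Relation.Unary.Any using (here; there)
open import Data.List.Relation.Unary.Unique.Propositional using (Unique)
import Data.List.Relation.Unary.Unique.Propositional.Properties as Unique
open import Data.List.Relation.Binary.Pointwise using (Pointwise; []; _∷_)
open import Data.List.Relation.Binary.Disjoint.Propositional using (Disjoint)
open import Data.List.Relation.Binary.BagAndSetEquality using (∼bag⇒↭)
open import Data.List.Relation.Binary.Permutation.Propositional.Properties using (↭-length)
open import Data.List.Membership.Propositional using (_∈_; _∉_)
open import Data.List.Membership.Propositional.Properties using (∈-map⁺; ∈-map⁻; ∈-++⁺ˡ; ∈-++⁺ʳ; ∈-++⁻; ∈-allFin; ∈-cartesianProductWith⁺; ∈-filter⁺; ∈-filter⁻)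
open import Data.List.Membership.Propositional.Properties.WithK using (unique∧set⇒bag)
open import Data.List.Membership.DecPropositional _≟_ using (_∈?_)
open import Function using (_∘_)
open import Function.Bundles using (_⇔_; mk⇔; Equivalence)
open import Relation.Binary.Definitions using (tri<; tri≈; tri>)
open import Relation.Binary.PropositionalEquality hiding ([_])
open import Relation.Nullary using (yes; no; does; contradiction)
open import Relation.Nullary.Decidable using (dec-true; dec-false; does-⇔)
open ≡-Reasoning

open import Defs

-- Catalan numbers as ballot numbers

-- ballot h a counts the lattice paths from height h to height 0 with a up-steps
-- that never go below 0.
ballot : ℕ → ℕ → ℕ
ballot h zero = 1
ballot zero (suc a) = ballot 1 a
ballot (suc h) (suc a) = ballot (suc (suc h)) a + ballot h (suc a)

k+m≡n⇒nCk≡nCm : ∀ {n} k m → k + m ≡ n → n C k ≡ n C m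
k+m≡n⇒nCk≡nCm k m refl = begin
  (k + m) C k             ≡⟨ nCk≡nC[n∸k] (m≤m+n k m) ⟩
  (k + m) C (k + m ∸ k)   ≡⟨ cong ((k + m) C_) (m+n∸m≡n k m) ⟩
  (k + m) C m             ∎

[k+1]*[n+1]C[k+1]≡[n+1]*nCk : ∀ n k → suc k * (suc n C suc k) ≡ suc n * (n C k)
[k+1]*[n+1]C[k+1]≡[n+1]*nCk n zero = trans (+-identityʳ _) (trans (nC1≡n (suc n)) (sym (*-identityʳ (suc n))))
[k+1]*[n+1]C[k+1]≡[n+1]*nCk zero (suc k) = *-zeroʳ (suc (suc k))
[k+1]*[n+1]C[k+1]≡[n+1]*nCk (suc n) (suc k) = begin
  suc (suc k) * (suc (suc n) C suc (suc k))      ≡⟨ cong (suc (suc k) *_) (pascal (suc n) (suc k)) ⟨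
  suc (suc k) * (X + Y)                          ≡⟨ regroup k X Y ⟩
  X + (suc k * X + suc (suc k) * Y)
    ≡⟨ cong (X +_) (cong₂ _+_ ([k+1]*[n+1]C[k+1]≡[n+1]*nCk n k) ([k+1]*[n+1]C[k+1]≡[n+1]*nCk n (suc k))) ⟩
  X + (suc n * (n C k) + suc n * (n C suc k))    ≡⟨ cong (X +_) (*-distribˡ-+ (suc n) (n C k) _) ⟨
  X + suc n * (n C k + n C suc k)                ≡⟨ cong (λ z → X + suc n * z) (pascal n k) ⟩
  X + suc n * X                                  ∎
  where
  X = suc n C suc k
  Y = suc n C suc (suc k)
  regroup : ∀ k X Y → suc (suc k) * (X + Y) ≡ X + (suc k * X + suc (suc k) * Y)
  regroup = solve-∀

-- The reflection principle: ballot h (1 + a) = N C (1 + a) − N C a for N = h + 2a + 2.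
ballot+C≡C : ∀ a h {N} → N ≡ suc (suc (h + (a + a))) → ballot h (suc a) + N C a ≡ N C suc a
ballot+C≡C zero zero refl = refl
ballot+C≡C zero (suc h) refl = trans (cong suc (ballot+C≡C zero h refl)) (pascal (suc (suc (h + 0))) 0)
ballot+C≡C (suc a) zero refl = begin
  ballot 1 (suc a) + suc N C suc a          ≡⟨ cong (ballot 1 (suc a) +_) (pascal N a) ⟨
  ballot 1 (suc a) + (N C a + N C suc a)    ≡⟨ +-assoc (ballot 1 (suc a)) _ _ ⟨
  ballot 1 (suc a) + N C a + N C suc a      ≡⟨ cong (_+ N C suc a) (ballot+C≡C a 1 (N≡ a)) ⟩
  N C suc a + N C suc a                     ≡⟨ cong (N C suc a +_) (k+m≡n⇒nCk≡nCm (suc a) (suc (suc a)) (2a+3≡N a)) ⟩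
  N C suc a + N C suc (suc a)               ≡⟨ pascal N (suc a) ⟩
  suc N C suc (suc a)                       ∎
  where
  N = suc (suc (a + suc a))
  N≡ : ∀ a → suc (suc (a + suc a)) ≡ suc (suc (1 + (a + a)))
  N≡ = solve-∀
  2a+3≡N : ∀ a → suc a + suc (suc a) ≡ suc (suc (a + suc a))
  2a+3≡N = solve-∀
ballot+C≡C (suc a) (suc h) refl = begin
  ballot (suc (suc h)) (suc a) + ballot h (suc (suc a)) + suc N C suc a
    ≡⟨ cong (ballot (suc (suc h)) (suc a) + ballot h (suc (suc a)) +_) (pascal N a) ⟨
  ballot (suc (suc h)) (suc a) + ballot h (suc (suc a)) + (N C a + N C suc a)
    ≡⟨ +-interchange (ballot (suc (suc h)) (suc a)) _ _ _ ⟩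
  (ballot (suc (suc h)) (suc a) + N C a) + (ballot h (suc (suc a)) + N C suc a)
    ≡⟨ cong₂ _+_ (ballot+C≡C a (suc (suc h)) (N≡ h a)) (ballot+C≡C (suc a) h refl) ⟩
  N C suc a + N C suc (suc a)
    ≡⟨ pascal N (suc a) ⟩
  suc N C suc (suc a)
    ∎
  where
  N = suc (suc (h + (suc a + suc a)))
  N≡ : ∀ h a → suc (suc (h + (suc a + suc a))) ≡ suc (suc (suc (suc h) + (a + a)))
  N≡ = solve-∀

[a+2]*[2a+2]Ca≡[a+1]*[2a+2]C[a+1] : ∀ a → suc (suc a) * (suc (a + suc a) C a) ≡ suc a * (suc (a + suc a) C suc a)
[a+2]*[2a+2]Ca≡[a+1]*[2a+2]C[a+1] a = begin
  suc (suc a) * (M C a)            ≡⟨ cong (suc (suc a) *_) (k+m≡n⇒nCk≡nCm a (suc (suc a)) (+-suc a (suc a))) ⟩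
  suc (suc a) * (M C suc (suc a))  ≡⟨ [k+1]*[n+1]C[k+1]≡[n+1]*nCk (a + suc a) (suc a) ⟩
  M * ((a + suc a) C suc a)        ≡⟨ cong (M *_) (k+m≡n⇒nCk≡nCm a (suc a) refl) ⟨
  M * ((a + suc a) C a)            ≡⟨ [k+1]*[n+1]C[k+1]≡[n+1]*nCk (a + suc a) a ⟨
  suc a * (M C suc a)              ∎
  where M = suc (a + suc a)

[a+2]*ballot0[a+1]≡[2a+2]C[a+1] : ∀ a → suc (suc a) * ballot 0 (suc a) ≡ suc (a + suc a) C suc a
[a+2]*ballot0[a+1]≡[2a+2]C[a+1] a = +-cancelʳ-≡ (suc a * (M C suc a)) _ _ (begin
  suc (suc a) * ballot 0 (suc a) + suc a * (M C suc a)
    ≡⟨ cong (suc (suc a) * ballot 0 (suc a) +_) ([a+2]*[2a+2]Ca≡[a+1]*[2a+2]C[a+1] a) ⟨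
  suc (suc a) * ballot 0 (suc a) + suc (suc a) * (M C a)
    ≡⟨ *-distribˡ-+ (suc (suc a)) (ballot 0 (suc a)) (M C a) ⟨
  suc (suc a) * (ballot 0 (suc a) + M C a)
    ≡⟨ cong (suc (suc a) *_) (ballot+C≡C a 0 (cong suc (+-suc a a))) ⟩
  suc (suc a) * (M C suc a)
    ∎)
  where M = suc (a + suc a)

catalan≡ballot : ∀ j → catalan j ≡ ballot 0 j
catalan≡ballot zero = refl
catalan≡ballot (suc a) = begin
  ((2 * suc a) C suc a) / suc (suc a)            ≡⟨ cong (λ X → (X C suc a) / suc (suc a)) (cong (suc a +_) (+-identityʳ (suc a))) ⟩
  (suc (a + suc a) C suc a) / suc (suc a)        ≡⟨ cong (_/ suc (suc a)) ([a+2]*ballot0[a+1]≡[2a+2]C[a+1] a) ⟨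
  (suc (suc a) * ballot 0 (suc a)) / suc (suc a) ≡⟨ cong (_/ suc (suc a)) (*-comm (suc (suc a)) (ballot 0 (suc a))) ⟩
  (ballot 0 (suc a) * suc (suc a)) / suc (suc a) ≡⟨ m*n/n≡m (ballot 0 (suc a)) (suc (suc a)) ⟩
  ballot 0 (suc a)                               ∎


-- Sums over compositions as ballot numbers

convolve : (ℕ → ℕ) → (ℕ → ℕ) → ℕ → ℕ
convolve f g zero = f 0 * g 0
convolve f g (suc x) = f 0 * g (suc x) + convolve (f ∘ suc) g x

shift : (ℕ → ℕ) → ℕ → ℕ
shift f zero = 0
shift f (suc i) = f i

convolve-cong : ∀ {f f′ g g′ : ℕ → ℕ} → (∀ u → f u ≡ f′ u) → (∀ u → g u ≡ g′ u) →
                ∀ x → convolve f g x ≡ convolve f′ g′ x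
convolve-cong ef eg zero = cong₂ _*_ (ef 0) (eg 0)
convolve-cong ef eg (suc x) = cong₂ _+_ (cong₂ _*_ (ef 0) (eg (suc x))) (convolve-cong (ef ∘ suc) eg x)

convolve-distribʳ-+ : ∀ f₁ f₂ g x → convolve (λ u → f₁ u + f₂ u) g x ≡ convolve f₁ g x + convolve f₂ g x
convolve-distribʳ-+ f₁ f₂ g zero = *-distribʳ-+ (g 0) (f₁ 0) (f₂ 0)
convolve-distribʳ-+ f₁ f₂ g (suc x) = begin
  (f₁ 0 + f₂ 0) * g (suc x) + convolve (λ u → f₁ (suc u) + f₂ (suc u)) g x
    ≡⟨ cong₂ _+_ (*-distribʳ-+ (g (suc x)) (f₁ 0) (f₂ 0)) (convolve-distribʳ-+ (f₁ ∘ suc) (f₂ ∘ suc) g x) ⟩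
  (f₁ 0 * g (suc x) + f₂ 0 * g (suc x)) + (convolve (f₁ ∘ suc) g x + convolve (f₂ ∘ suc) g x)
    ≡⟨ +-interchange (f₁ 0 * g (suc x)) _ _ _ ⟩
  (f₁ 0 * g (suc x) + convolve (f₁ ∘ suc) g x) + (f₂ 0 * g (suc x) + convolve (f₂ ∘ suc) g x)
    ∎

convolve-shift : ∀ f g x → convolve f (shift g) (suc x) ≡ convolve f g x
convolve-shift f g zero = trans (cong (f 0 * g 0 +_) (*-zeroʳ (f 1))) (+-identityʳ _)
convolve-shift f g (suc x) = cong (f 0 * g (suc x) +_) (convolve-shift (f ∘ suc) g x)

adjacentSum : (ℕ → ℕ) → ℕ → ℕ
adjacentSum f i = shift f i + f i

adjacentSum-+ : ∀ f g i → adjacentSum (λ j → f j + g j) i ≡ adjacentSum f i + adjacentSum g i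
adjacentSum-+ f g zero = refl
adjacentSum-+ f g (suc i) = +-interchange (f i) (g i) (f (suc i)) (g (suc i))

adjacentSum-cong : ∀ {f g} → (∀ j → f j ≡ g j) → ∀ i → adjacentSum f i ≡ adjacentSum g i
adjacentSum-cong e zero = cong (0 +_) (e 0)
adjacentSum-cong e (suc i) = cong₂ _+_ (e i) (e (suc i))

-- Decompose a path from height h + h′ + 1 at its first visit to height h′.
ballot-convolve : ∀ a h h′ → ballot (suc (h + h′)) a ≡ convolve (ballot h) (ballot h′) a
ballot-convolve zero h h′ = refl
ballot-convolve (suc a) zero h′ = begin
  ballot (suc (suc h′)) a + ballot h′ (suc a)      ≡⟨ +-comm (ballot (suc (suc h′)) a) _ ⟩
  ballot h′ (suc a) + ballot (suc (suc h′)) a      ≡⟨ cong₂ _+_ (sym (*-identityˡ _)) (ballot-convolve a 1 h′) ⟩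
  1 * ballot h′ (suc a) + convolve (ballot 1) (ballot h′) a ∎
ballot-convolve (suc a) (suc h) h′ = begin
  ballot (suc (suc (suc (h + h′)))) a + ballot (suc (h + h′)) (suc a)
    ≡⟨ cong₂ _+_ (ballot-convolve a (suc (suc h)) h′) (ballot-convolve (suc a) h h′) ⟩
  X + (1 * ballot h′ (suc a) + Y)
    ≡⟨ x+[y+z]≡y+[x+z] X _ Y ⟩
  1 * ballot h′ (suc a) + (X + Y)
    ≡⟨ cong (1 * ballot h′ (suc a) +_) (convolve-distribʳ-+ (ballot (suc (suc h))) (ballot h ∘ suc) (ballot h′) a) ⟨
  1 * ballot h′ (suc a) + convolve (λ u → ballot (suc (suc h)) u + ballot h (suc u)) (ballot h′) a
    ∎
  where
  X = convolve (ballot (suc (suc h))) (ballot h′) a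
  Y = convolve (ballot h ∘ suc) (ballot h′) a

raisedBallot : ℕ → ℕ → ℕ → ℕ
raisedBallot h x zero = ballot h x
raisedBallot h zero (suc j) = 0
raisedBallot h (suc x) (suc j) = raisedBallot (suc (suc h)) x j

convolve-raisedBallot : ∀ j h h′ x → convolve (ballot h) (λ y → raisedBallot h′ y j) x ≡ raisedBallot (suc (h + h′)) x j
convolve-raisedBallot zero h h′ x = sym (ballot-convolve x h h′)
convolve-raisedBallot (suc j) h h′ zero = refl
convolve-raisedBallot (suc j) h h′ (suc x) = begin
  convolve (ballot h) (λ y → raisedBallot h′ y (suc j)) (suc x)
    ≡⟨ convolve-cong {f = ballot h} (λ _ → refl) shifted (suc x) ⟩
  convolve (ballot h) (shift (λ y → raisedBallot (suc (suc h′)) y j)) (suc x)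
    ≡⟨ convolve-shift (ballot h) _ x ⟩
  convolve (ballot h) (λ y → raisedBallot (suc (suc h′)) y j) x
    ≡⟨ convolve-raisedBallot j h (suc (suc h′)) x ⟩
  raisedBallot (suc (h + suc (suc h′))) x j
    ≡⟨ cong (λ z → raisedBallot (suc z) x j) (trans (+-suc h (suc h′)) (cong suc (+-suc h h′))) ⟩
  raisedBallot (suc (suc (suc (h + h′)))) x j
    ∎
  where
  shifted : ∀ u → raisedBallot h′ u (suc j) ≡ shift (λ y → raisedBallot (suc (suc h′)) y j) u
  shifted zero = refl
  shifted (suc u) = refl

raisedBallot-pascal : ∀ h x j → raisedBallot (suc h) x j + raisedBallot (suc h) x (suc j) ≡ raisedBallot (suc (suc h)) x j
raisedBallot-pascal h zero zero = refl
raisedBallot-pascal h (suc x) zero = +-comm (ballot (suc h) (suc x)) _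
raisedBallot-pascal h zero (suc j) = refl
raisedBallot-pascal h (suc x) (suc j) = raisedBallot-pascal (suc (suc h)) x j

raisedBallot-suc-zero : ∀ h j → raisedBallot (suc h) 0 j ≡ raisedBallot h 0 j
raisedBallot-suc-zero h zero = refl
raisedBallot-suc-zero h (suc j) = refl

raisedBallot-suc-suc : ∀ h x j → raisedBallot (suc h) (suc x) j ≡ raisedBallot (suc (suc h)) x j + raisedBallot h (suc x) j
raisedBallot-suc-suc h x zero = refl
raisedBallot-suc-suc h zero (suc j) = raisedBallot-suc-zero (suc (suc h)) j
raisedBallot-suc-suc h (suc x) (suc j) = raisedBallot-suc-suc (suc (suc h)) x j

raisedBallot-zero-suc : ∀ x i → raisedBallot 0 (suc x) i ≡ adjacentSum (raisedBallot 1 x) i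
raisedBallot-zero-suc x zero = refl
raisedBallot-zero-suc x (suc j) = sym (raisedBallot-pascal 0 x j)

sum-map-concatMap : ∀ {A B : Set} (F : B → ℕ) (f : A → List B) xs →
                    sum (map F (concatMap f xs)) ≡ sum (map (λ x → sum (map F (f x))) xs)
sum-map-concatMap F f [] = refl
sum-map-concatMap F f (x ∷ xs) = begin
  sum (map F (f x ++ concatMap f xs))               ≡⟨ cong sum (map-++ F (f x) (concatMap f xs)) ⟩
  sum (map F (f x) ++ map F (concatMap f xs))       ≡⟨ sum-++ (map F (f x)) _ ⟩
  sum (map F (f x)) + sum (map F (concatMap f xs))  ≡⟨ cong (sum (map F (f x)) +_) (sum-map-concatMap F f xs) ⟩
  sum (map F (f x)) + sum (map (λ x → sum (map F (f x))) xs) ∎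

catalanProduct : List ℕ → ℕ
catalanProduct ks = product (map catalan ks)

sum-catalanProduct-∷ : ∀ c ks → sum (map catalanProduct (map (c ∷_) ks)) ≡ catalan c * sum (map catalanProduct ks)
sum-catalanProduct-∷ c [] = sym (*-zeroʳ (catalan c))
sum-catalanProduct-∷ c (k ∷ ks) = begin
  catalan c * catalanProduct k + sum (map catalanProduct (map (c ∷_) ks))  ≡⟨ cong (catalan c * catalanProduct k +_) (sum-catalanProduct-∷ c ks) ⟩
  catalan c * catalanProduct k + catalan c * sum (map catalanProduct ks)    ≡⟨ *-distribˡ-+ (catalan c) _ _ ⟨
  catalan c * sum (map catalanProduct (k ∷ ks)) ∎

sum-upTo-convolve : ∀ x f g → sum (map (λ k → f k * g (x ∸ k)) (upTo (suc x))) ≡ convolve f g x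
sum-upTo-convolve x f g = trans (cong sum (map-upTo _ (suc x))) (sum-applyUpTo x f)
  where
  sum-applyUpTo : ∀ x f → sum (applyUpTo (λ k → f k * g (x ∸ k)) (suc x)) ≡ convolve f g x
  sum-applyUpTo zero f = +-identityʳ _
  sum-applyUpTo (suc x) f = cong (f 0 * g (suc x) +_) (sum-applyUpTo x (f ∘ suc))

catalanCompSum-suc : ∀ p x → catalanCompSum (suc p) (suc x) ≡ convolve (catalan ∘ suc) (catalanCompSum p) x
catalanCompSum-suc p x = begin
  sum (map catalanProduct (concatMap f (upTo (suc x))))
    ≡⟨ sum-map-concatMap catalanProduct f (upTo (suc x)) ⟩
  sum (map (λ k → sum (map catalanProduct (f k))) (upTo (suc x)))
    ≡⟨ cong sum (map-cong (λ k → sum-catalanProduct-∷ (suc k) (compositions p (x ∸ k))) (upTo (suc x))) ⟩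
  sum (map (λ k → catalan (suc k) * catalanCompSum p (x ∸ k)) (upTo (suc x)))
    ≡⟨ sum-upTo-convolve x (catalan ∘ suc) (catalanCompSum p) ⟩
  convolve (catalan ∘ suc) (catalanCompSum p) x
    ∎
  where
  f = λ k → map (suc k ∷_) (compositions p (suc x ∸ suc k))

convolve-catalanCompSum-0 : ∀ f x → convolve f (catalanCompSum 0) x ≡ f x
convolve-catalanCompSum-0 f zero = *-identityʳ (f 0)
convolve-catalanCompSum-0 f (suc x) = trans (cong (_+ convolve (f ∘ suc) (catalanCompSum 0) x) (*-zeroʳ (f 0)))
                                            (convolve-catalanCompSum-0 (f ∘ suc) x)

-- Sequences of p + 1 nonempty Dyck paths of total semilength x + 1 correspond to
-- paths from height 2p + 1.
catalanCompSum≡raisedBallot : ∀ p x → catalanCompSum (suc p) (suc x) ≡ raisedBallot 1 x p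
catalanCompSum≡raisedBallot zero x =
  trans (catalanCompSum-suc 0 x) (trans (convolve-catalanCompSum-0 _ x) (catalan≡ballot (suc x)))
catalanCompSum≡raisedBallot (suc p) x = begin
  catalanCompSum (suc (suc p)) (suc x)
    ≡⟨ catalanCompSum-suc (suc p) x ⟩
  convolve (catalan ∘ suc) (catalanCompSum (suc p)) x
    ≡⟨ convolve-cong (catalan≡ballot ∘ suc) shifted x ⟩
  convolve (ballot 1) (shift (λ y → raisedBallot 1 y p)) x
    ≡⟨ convolve-shifted x ⟩
  raisedBallot 1 x (suc p)
    ∎
  where
  shifted : ∀ u → catalanCompSum (suc p) u ≡ shift (λ y → raisedBallot 1 y p) u
  shifted zero = refl
  shifted (suc u) = catalanCompSum≡raisedBallot p u
  convolve-shifted : ∀ x → convolve (ballot 1) (shift (λ y → raisedBallot 1 y p)) x ≡ raisedBallot 1 x (suc p)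
  convolve-shifted zero = refl
  convolve-shifted (suc x) = trans (convolve-shift (ballot 1) _ x) (convolve-raisedBallot p 1 1 x)

catalanCompSum-pair : ∀ i n → catalanCompSum i n + catalanCompSum (suc i) n ≡ raisedBallot 0 n i
catalanCompSum-pair zero zero = refl
catalanCompSum-pair (suc j) zero = refl
catalanCompSum-pair zero (suc x) = catalanCompSum≡raisedBallot 0 x
catalanCompSum-pair (suc j) (suc x) =
  trans (cong₂ _+_ (catalanCompSum≡raisedBallot j x) (catalanCompSum≡raisedBallot (suc j) x)) (raisedBallot-pascal 0 x j)


-- Counting words by inversions

wordsWith : ℕ → ℕ → List (List Bool)
wordsWith zero zero = [ [] ]
wordsWith zero (suc b) = map (false ∷_) (wordsWith zero b)
wordsWith (suc a) zero = map (true ∷_) (wordsWith a zero)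
wordsWith (suc a) (suc b) = map (true ∷_) (wordsWith a (suc b)) ++ map (false ∷_) (wordsWith (suc a) b)

-- A word w lists 1, 2, … in order, true sending the number to the top row and false
-- to the bottom row; p and q count the entries placed so far in the two rows.  A
-- column is complete when its second entry arrives, and then we emit whether its
-- top entry is the smaller one.
columnSigns : ℕ → ℕ → List Bool → List Bool
columnSigns p q [] = []
columnSigns p q (true ∷ w) = if p <ᵇ q then false ∷ columnSigns (suc p) q w else columnSigns (suc p) q w
columnSigns p q (false ∷ w) = if q <ᵇ p then true ∷ columnSigns p (suc q) w else columnSigns p (suc q) w

changed : Maybe Bool → Bool → ℕ
changed nothing s = 0
changed (just r) s = b2n (r xor s)

lastColumnInverted : Maybe Bool → ℕ
lastColumnInverted (just false) = 1
lastColumnInverted _ = 0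

-- The number of inversions of a row-standard tableau, read off its column signs;
-- σ is the sign of the previous column, if any.
signChanges : Maybe Bool → List Bool → ℕ
signChanges σ [] = lastColumnInverted σ
signChanges σ (s ∷ ss) = changed σ s + signChanges (just s) ss

count : {A : Set} → (A → ℕ) → ℕ → List A → ℕ
count f i xs = length (filterᵇ (λ x → f x ≡ᵇ i) xs)

count-++ : ∀ {A : Set} (f : A → ℕ) i xs ys → count f i (xs ++ ys) ≡ count f i xs + count f i ys
count-++ f i xs ys = trans (cong length (filter-++ _ xs ys)) (length-++ (filterᵇ _ xs))

count-map : ∀ {A B : Set} (f : B → ℕ) (g : A → B) i xs → count f i (map g xs) ≡ count (f ∘ g) i xs
count-map f g i [] = refl
count-map f g i (x ∷ xs) with f (g x) ≡ᵇ i
... | true = cong suc (count-map f g i xs)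
... | false = count-map f g i xs

count-cong : ∀ {A : Set} {f f′ : A → ℕ} → (∀ x → f x ≡ f′ x) → ∀ i xs → count f i xs ≡ count f′ i xs
count-cong e i [] = refl
count-cong {f′ = f′} e i (x ∷ xs) rewrite e x with f′ x ≡ᵇ i
... | true = cong suc (count-cong e i xs)
... | false = count-cong e i xs

shiftBy : ℕ → (ℕ → ℕ) → ℕ → ℕ
shiftBy zero f = f
shiftBy (suc c) f = shift (shiftBy c f)

count-+ : ∀ {A : Set} c (f : A → ℕ) i xs → count (λ x → c + f x) i xs ≡ shiftBy c (λ j → count f j xs) i
count-+ zero f i xs = refl
count-+ (suc c) f zero xs = none xs
  where
  none : ∀ xs → count (λ x → suc (c + f x)) 0 xs ≡ 0
  none [] = refl
  none (x ∷ xs) = none xs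
count-+ (suc c) f (suc i) xs = count-+ c f i xs

shiftBy-cong : ∀ c {f g : ℕ → ℕ} → (∀ j → f j ≡ g j) → ∀ i → shiftBy c f i ≡ shiftBy c g i
shiftBy-cong zero e i = e i
shiftBy-cong (suc c) e zero = refl
shiftBy-cong (suc c) e (suc i) = shiftBy-cong c e i

shiftBy-+ : ∀ c f g i → shiftBy c f i + shiftBy c g i ≡ shiftBy c (λ j → f j + g j) i
shiftBy-+ zero f g i = refl
shiftBy-+ (suc c) f g zero = refl
shiftBy-+ (suc c) f g (suc i) = shiftBy-+ c f g i

columnSigns-suc : ∀ p q w → columnSigns (suc p) (suc q) w ≡ columnSigns p q w
columnSigns-suc p q [] = refl
columnSigns-suc p q (true ∷ w) = cong (λ ss → if p <ᵇ q then false ∷ ss else ss) (columnSigns-suc (suc p) q w)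
columnSigns-suc p q (false ∷ w) = cong (λ ss → if q <ᵇ p then true ∷ ss else ss) (columnSigns-suc p (suc q) w)

signCount : ℕ → ℕ → Maybe Bool → List (List Bool) → ℕ → ℕ
signCount p q σ ws i = count (λ w → signChanges σ (columnSigns p q w)) i ws

signCount-++ : ∀ p q σ ws vs i → signCount p q σ (ws ++ vs) i ≡ signCount p q σ ws i + signCount p q σ vs i
signCount-++ p q σ ws vs i = count-++ (signChanges σ ∘ columnSigns p q) i ws vs

signCount-silent : ∀ {p q p′ q′} σ c ws i → (∀ w → columnSigns p q (c ∷ w) ≡ columnSigns p′ q′ w) →
                   signCount p q σ (map (c ∷_) ws) i ≡ signCount p′ q′ σ ws i
signCount-silent {p} {q} σ c ws i e =
  trans (count-map (signChanges σ ∘ columnSigns p q) (c ∷_) i ws) (count-cong (cong (signChanges σ) ∘ e) i ws)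

signCount-emit : ∀ {p q p′ q′} σ c s ws i → (∀ w → columnSigns p q (c ∷ w) ≡ s ∷ columnSigns p′ q′ w) →
                 signCount p q σ (map (c ∷_) ws) i ≡ shiftBy (changed σ s) (signCount p′ q′ (just s) ws) i
signCount-emit {p} {q} {p′} {q′} σ c s ws i e =
  trans (count-map (signChanges σ ∘ columnSigns p q) (c ∷_) i ws)
        (trans (count-cong (cong (signChanges σ) ∘ e) i ws)
               (count-+ (changed σ s) (signChanges (just s) ∘ columnSigns p′ q′) i ws))

even : ℕ → Bool
even zero = true
even (suc i) = not (even i)

onEven onOdd : (ℕ → ℕ) → ℕ → ℕ
onEven f i = if even i then f i else 0
onOdd f i = if even i then 0 else f i

onEven+onOdd : ∀ f i → onEven f i + onOdd f i ≡ f i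
onEven+onOdd f i with even i
... | true = +-identityʳ (f i)
... | false = refl

onEven+shift-onOdd : ∀ f i → onEven f i + shift (onOdd f) i ≡ onEven (adjacentSum f) i
onEven+shift-onOdd f zero = +-identityʳ (f 0)
onEven+shift-onOdd f (suc i) with even i
... | true = refl
... | false = +-comm (f (suc i)) (f i)

shift-onEven+onOdd : ∀ f i → shift (onEven f) i + onOdd f i ≡ onOdd (adjacentSum f) i
shift-onEven+onOdd f zero = refl
shift-onEven+onOdd f (suc i) with even i
... | true = refl
... | false = refl

onEven-+ : ∀ f g i → onEven (λ j → f j + g j) i ≡ onEven f i + onEven g i
onEven-+ f g i with even i
... | true = refl
... | false = refl

onOdd-+ : ∀ f g i → onOdd (λ j → f j + g j) i ≡ onOdd f i + onOdd g i
onOdd-+ f g i with even i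
... | true = refl
... | false = refl

onEven-cong : ∀ {f g} → (∀ j → f j ≡ g j) → ∀ i → onEven f i ≡ onEven g i
onEven-cong e i = cong (λ v → if even i then v else 0) (e i)

onOdd-cong : ∀ {f g} → (∀ j → f j ≡ g j) → ∀ i → onOdd f i ≡ onOdd g i
onOdd-cong e i = cong (λ v → if even i then 0 else v) (e i)

evenCount oddCount : ℕ → ℕ → ℕ → ℕ
evenCount h x = onEven (adjacentSum (raisedBallot h x))
oddCount h x = onOdd (adjacentSum (raisedBallot h x))

evenCount-suc-zero : ∀ h i → evenCount (suc h) 0 i ≡ evenCount h 0 i
evenCount-suc-zero h = onEven-cong (adjacentSum-cong (raisedBallot-suc-zero h))

oddCount-suc-zero : ∀ h i → oddCount (suc h) 0 i ≡ oddCount h 0 i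
oddCount-suc-zero h = onOdd-cong (adjacentSum-cong (raisedBallot-suc-zero h))

adjacentSum-raisedBallot-suc-suc : ∀ h x i →
  adjacentSum (raisedBallot (suc h) (suc x)) i ≡ adjacentSum (raisedBallot (suc (suc h)) x) i + adjacentSum (raisedBallot h (suc x)) i
adjacentSum-raisedBallot-suc-suc h x i =
  trans (adjacentSum-cong (raisedBallot-suc-suc h x) i) (adjacentSum-+ (raisedBallot (suc (suc h)) x) (raisedBallot h (suc x)) i)

evenCount-suc-suc : ∀ h x i → evenCount (suc h) (suc x) i ≡ evenCount (suc (suc h)) x i + evenCount h (suc x) i
evenCount-suc-suc h x i =
  trans (onEven-cong (adjacentSum-raisedBallot-suc-suc h x) i)
        (onEven-+ (adjacentSum (raisedBallot (suc (suc h)) x)) (adjacentSum (raisedBallot h (suc x))) i)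

oddCount-suc-suc : ∀ h x i → oddCount (suc h) (suc x) i ≡ oddCount (suc (suc h)) x i + oddCount h (suc x) i
oddCount-suc-suc h x i =
  trans (onOdd-cong (adjacentSum-raisedBallot-suc-suc h x) i)
        (onOdd-+ (adjacentSum (raisedBallot (suc (suc h)) x)) (adjacentSum (raisedBallot h (suc x))) i)

-- The completions from height p − q = h (fromAbove) or −(h + 1) (fromBelow) with x
-- letters true left, by their number i of further inversions, σ being the sign of the
-- last completed column.  Above 0 this number is even and below 0 it is odd, plus one
-- when σ differs from the current side.
fromAbove : ℕ → ℕ → Maybe Bool → ℕ → ℕ
fromAbove zero x (just true) = evenCount 0 x
fromAbove zero x (just false) = oddCount 0 x
fromAbove zero x nothing = raisedBallot 0 x
fromAbove (suc h) x σ = shiftBy (changed σ true) (evenCount (suc h) x)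

fromBelow : ℕ → ℕ → Maybe Bool → ℕ → ℕ
fromBelow h x σ = shiftBy (changed σ false) (oddCount (suc h) x)

fromAbove-true : ∀ h x i → fromAbove h x (just true) i ≡ evenCount h x i
fromAbove-true zero x i = refl
fromAbove-true (suc h) x i = refl

fromAbove-zero-suc : ∀ x σ i → fromAbove 1 x σ i + fromBelow 0 x σ i ≡ fromAbove 0 (suc x) σ i
fromAbove-zero-suc x (just true) i =
  trans (onEven+shift-onOdd (adjacentSum (raisedBallot 1 x)) i)
        (onEven-cong (sym ∘ adjacentSum-cong (raisedBallot-zero-suc x)) i)
fromAbove-zero-suc x (just false) i =
  trans (shift-onEven+onOdd (adjacentSum (raisedBallot 1 x)) i)
        (onOdd-cong (sym ∘ adjacentSum-cong (raisedBallot-zero-suc x)) i)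
fromAbove-zero-suc x nothing i =
  trans (onEven+onOdd (adjacentSum (raisedBallot 1 x)) i) (sym (raisedBallot-zero-suc x i))

signCount-empty : ∀ σ i → signCount 0 0 σ [ [] ] i ≡ fromAbove 0 0 σ i
signCount-empty (just true) zero = refl
signCount-empty (just true) (suc zero) = refl
signCount-empty (just true) (suc (suc j)) with even j
... | true = refl
... | false = refl
signCount-empty (just false) zero = refl
signCount-empty (just false) (suc zero) = refl
signCount-empty (just false) (suc (suc j)) with even j
... | true = refl
... | false = refl
signCount-empty nothing zero = refl
signCount-empty nothing (suc i) = refl

mutual
  signCount-above : ∀ x h {a b} → a ≡ x → b ≡ x + h → ∀ σ i → signCount h 0 σ (wordsWith a b) i ≡ fromAbove h x σ i
  signCount-above zero zero refl refl σ i = signCount-empty σ i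
  signCount-above zero (suc h) refl refl σ i = begin
    signCount (suc h) 0 σ (map (false ∷_) (wordsWith 0 h)) i
      ≡⟨ signCount-emit σ false true (wordsWith 0 h) i (cong (true ∷_) ∘ columnSigns-suc h 0) ⟩
    shiftBy (changed σ true) (signCount h 0 (just true) (wordsWith 0 h)) i
      ≡⟨ shiftBy-cong (changed σ true) (λ j → trans (signCount-above 0 h refl refl (just true) j) (fromAbove-true h 0 j)) i ⟩
    shiftBy (changed σ true) (evenCount h 0) i
      ≡⟨ shiftBy-cong (changed σ true) (sym ∘ evenCount-suc-zero h) i ⟩
    fromAbove (suc h) 0 σ i ∎
  signCount-above (suc x) zero refl refl σ i = begin
    signCount 0 0 σ (map (true ∷_) ws ++ map (false ∷_) vs) i
      ≡⟨ signCount-++ 0 0 σ (map (true ∷_) ws) (map (false ∷_) vs) i ⟩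
    signCount 0 0 σ (map (true ∷_) ws) i + signCount 0 0 σ (map (false ∷_) vs) i
      ≡⟨ cong₂ _+_ (signCount-silent σ true ws i (λ _ → refl)) (signCount-silent σ false vs i (λ _ → refl)) ⟩
    signCount 1 0 σ ws i + signCount 0 1 σ vs i
      ≡⟨ cong₂ _+_ (signCount-above x 1 refl (sym (+-suc x 0)) σ i) (signCount-below x 0 (+-comm 1 x) (+-identityʳ x) σ i) ⟩
    fromAbove 1 x σ i + fromBelow 0 x σ i
      ≡⟨ fromAbove-zero-suc x σ i ⟩
    fromAbove 0 (suc x) σ i ∎
    where
    ws = wordsWith x (suc (x + 0))
    vs = wordsWith (suc x) (x + 0)
  signCount-above (suc x) (suc h) refl refl σ i = begin
    signCount (suc h) 0 σ (map (true ∷_) ws ++ map (false ∷_) vs) i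
      ≡⟨ signCount-++ (suc h) 0 σ (map (true ∷_) ws) (map (false ∷_) vs) i ⟩
    signCount (suc h) 0 σ (map (true ∷_) ws) i + signCount (suc h) 0 σ (map (false ∷_) vs) i
      ≡⟨ cong₂ _+_ (signCount-silent σ true ws i (λ _ → refl))
                   (signCount-emit σ false true vs i (cong (true ∷_) ∘ columnSigns-suc h 0)) ⟩
    signCount (suc (suc h)) 0 σ ws i + shiftBy c (signCount h 0 (just true) vs) i
      ≡⟨ cong₂ _+_ (signCount-above x (suc (suc h)) refl (sym (+-suc x (suc h))) σ i)
                   (shiftBy-cong c (λ j → trans (signCount-above (suc x) h refl (+-suc x h) (just true) j) (fromAbove-true h (suc x) j)) i) ⟩
    shiftBy c (evenCount (suc (suc h)) x) i + shiftBy c (evenCount h (suc x)) i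
      ≡⟨ shiftBy-+ c (evenCount (suc (suc h)) x) (evenCount h (suc x)) i ⟩
    shiftBy c (λ j → evenCount (suc (suc h)) x j + evenCount h (suc x) j) i
      ≡⟨ shiftBy-cong c (sym ∘ evenCount-suc-suc h x) i ⟩
    fromAbove (suc h) (suc x) σ i ∎
    where
    c = changed σ true
    ws = wordsWith x (suc (x + suc h))
    vs = wordsWith (suc x) (x + suc h)

  signCount-below : ∀ x h {a b} → a ≡ x + suc h → b ≡ x → ∀ σ i → signCount 0 (suc h) σ (wordsWith a b) i ≡ fromBelow h x σ i
  signCount-below zero h refl refl σ i = begin
    signCount 0 (suc h) σ (map (true ∷_) (wordsWith h 0)) i
      ≡⟨ signCount-emit σ true false (wordsWith h 0) i (cong (false ∷_) ∘ columnSigns-suc 0 h) ⟩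
    shiftBy (changed σ false) (signCount 0 h (just false) (wordsWith h 0)) i
      ≡⟨ shiftBy-cong (changed σ false) (signCount-belowFalse 0 h refl refl) i ⟩
    shiftBy (changed σ false) (oddCount h 0) i
      ≡⟨ shiftBy-cong (changed σ false) (sym ∘ oddCount-suc-zero h) i ⟩
    fromBelow h 0 σ i ∎
  signCount-below (suc x) h refl refl σ i = begin
    signCount 0 (suc h) σ (map (true ∷_) ws ++ map (false ∷_) vs) i
      ≡⟨ signCount-++ 0 (suc h) σ (map (true ∷_) ws) (map (false ∷_) vs) i ⟩
    signCount 0 (suc h) σ (map (true ∷_) ws) i + signCount 0 (suc h) σ (map (false ∷_) vs) i
      ≡⟨ cong₂ _+_ (signCount-emit σ true false ws i (cong (false ∷_) ∘ columnSigns-suc 0 h))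
                   (signCount-silent σ false vs i (λ _ → refl)) ⟩
    shiftBy c (signCount 0 h (just false) ws) i + signCount 0 (suc (suc h)) σ vs i
      ≡⟨ cong₂ _+_ (shiftBy-cong c (signCount-belowFalse (suc x) h (+-suc x h) refl) i)
                   (signCount-below x (suc h) (sym (+-suc x (suc h))) refl σ i) ⟩
    shiftBy c (oddCount h (suc x)) i + shiftBy c (oddCount (suc (suc h)) x) i
      ≡⟨ shiftBy-+ c (oddCount h (suc x)) (oddCount (suc (suc h)) x) i ⟩
    shiftBy c (λ j → oddCount h (suc x) j + oddCount (suc (suc h)) x j) i
      ≡⟨ shiftBy-cong c (λ j → trans (+-comm (oddCount h (suc x) j) _) (sym (oddCount-suc-suc h x j))) i ⟩
    fromBelow h (suc x) σ i ∎
    where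
    c = changed σ false
    ws = wordsWith (x + suc h) (suc x)
    vs = wordsWith (suc (x + suc h)) x

  signCount-belowFalse : ∀ x h {a b} → a ≡ x + h → b ≡ x → ∀ i → signCount 0 h (just false) (wordsWith a b) i ≡ oddCount h x i
  signCount-belowFalse x zero ea eb i =
    signCount-above x 0 (trans ea (+-identityʳ x)) (trans eb (sym (+-identityʳ x))) (just false) i
  signCount-belowFalse x (suc h) ea eb i = signCount-below x h ea eb (just false) i

signCount-balanced : ∀ n i → signCount 0 0 nothing (wordsWith n n) i ≡ raisedBallot 0 n i
signCount-balanced n i = signCount-above n 0 refl (sym (+-identityʳ n)) nothing i


-- Tableaux as words

data IncreasingFrom : ℕ → List ℕ → Set where
  [] : ∀ {lo} → IncreasingFrom lo []
  _∷_ : ∀ {lo x xs} → lo ≤ x → IncreasingFrom (suc x) xs → IncreasingFrom lo (x ∷ xs)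

IncreasingFrom-weaken : ∀ {lo lo′ xs} → lo ≤ lo′ → IncreasingFrom lo′ xs → IncreasingFrom lo xs
IncreasingFrom-weaken lo≤lo′ [] = []
IncreasingFrom-weaken lo≤lo′ (lo′≤x ∷ xs) = ≤-trans lo≤lo′ lo′≤x ∷ xs

IncreasingFrom⇒All≤ : ∀ {lo xs} → IncreasingFrom lo xs → All (lo ≤_) xs
IncreasingFrom⇒All≤ [] = []
IncreasingFrom⇒All≤ (lo≤x ∷ xs) = lo≤x ∷ All.map (≤-trans lo≤x ∘ <⇒≤) (IncreasingFrom⇒All≤ xs)

IncreasingFrom-∉ : ∀ {lo xs} → IncreasingFrom (suc lo) xs → lo ∉ xs
IncreasingFrom-∉ xs lo∈xs = <-irrefl refl (All.lookup (IncreasingFrom⇒All≤ xs) lo∈xs)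

positions : Bool → ℕ → List Bool → List ℕ
positions c k [] = []
positions c k (d ∷ w) with d ≟ᴮ c
... | yes _ = k ∷ positions c (suc k) w
... | no _ = positions c (suc k) w

positions-increasing : ∀ c k w → IncreasingFrom k (positions c k w)
positions-increasing c k [] = []
positions-increasing c k (d ∷ w) with d ≟ᴮ c
... | yes _ = ≤-refl ∷ positions-increasing c (suc k) w
... | no _ = IncreasingFrom-weaken (n≤1+n k) (positions-increasing c (suc k) w)

positions-< : ∀ c k w → All (_< k + length w) (positions c k w)
positions-< c k [] = []
positions-< c k (d ∷ w) with d ≟ᴮ c | subst (λ h → All (_< h) (positions c (suc k) w)) (sym (+-suc k (length w))) (positions-< c (suc k) w)
... | yes _ | rest = m<m+n k z<s ∷ rest
... | no _ | rest = rest

positions-disjoint : ∀ k w → Disjoint (positions true k w) (positions false k w)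
positions-disjoint k (true ∷ w) (here refl , k∈) = IncreasingFrom-∉ (positions-increasing false (suc k) w) k∈
positions-disjoint k (true ∷ w) (there j∈ , j∈′) = positions-disjoint (suc k) w (j∈ , j∈′)
positions-disjoint k (false ∷ w) (k∈ , here refl) = IncreasingFrom-∉ (positions-increasing true (suc k) w) k∈
positions-disjoint k (false ∷ w) (j∈ , there j∈′) = positions-disjoint (suc k) w (j∈ , j∈′)

length-positions : ∀ k w → length w ≡ length (positions true k w) + length (positions false k w)
length-positions k [] = refl
length-positions k (true ∷ w) = cong suc (length-positions (suc k) w)
length-positions k (false ∷ w) = trans (cong suc (length-positions (suc k) w)) (sym (+-suc _ _))

indicator : List ℕ → ℕ → ℕ → List Bool
indicator t k zero = []
indicator t k (suc m) = does (k ∈? t) ∷ indicator t (suc k) m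

indicator-∷ : ∀ {x} t k m → x < k → indicator (x ∷ t) k m ≡ indicator t k m
indicator-∷ t k zero x<k = refl
indicator-∷ {x} t k (suc m) x<k =
  cong₂ _∷_ (does-⇔ (mk⇔ drop-x there) (k ∈? x ∷ t) (k ∈? t)) (indicator-∷ t (suc k) m (m<n⇒m<1+n x<k))
  where
  drop-x : k ∈ x ∷ t → k ∈ t
  drop-x (here refl) = contradiction x<k (<-irrefl refl)
  drop-x (there k∈t) = k∈t

indicator-positions : ∀ k w → indicator (positions true k w) k (length w) ≡ w
indicator-positions k [] = refl
indicator-positions k (true ∷ w) = cong₂ _∷_ (dec-true (k ∈? k ∷ positions true (suc k) w) (here refl))
  (trans (indicator-∷ (positions true (suc k) w) (suc k) (length w) ≤-refl) (indicator-positions (suc k) w))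
indicator-positions k (false ∷ w) = cong₂ _∷_ (dec-false (k ∈? positions true (suc k) w) (IncreasingFrom-∉ (positions-increasing true (suc k) w)))
  (indicator-positions (suc k) w)

indicator-starts : ∀ t lo m → indicator (lo ∷ t) lo (suc m) ≡ true ∷ indicator t (suc lo) m
indicator-starts t lo m = cong₂ _∷_ (dec-true (lo ∈? lo ∷ t) (here refl)) (indicator-∷ t (suc lo) m ≤-refl)

indicator-skips : ∀ t lo m → IncreasingFrom (suc lo) t → indicator t lo (suc m) ≡ false ∷ indicator t (suc lo) m
indicator-skips t lo m it = cong (_∷ indicator t (suc lo) m) (dec-false (lo ∈? t) (IncreasingFrom-∉ it))

data SplitAt (lo : ℕ) : List ℕ → Set where
  starts : ∀ {t} → IncreasingFrom (suc lo) t → SplitAt lo (lo ∷ t)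
  skips : ∀ {t} → IncreasingFrom (suc lo) t → SplitAt lo t

splitAt : ∀ {lo t} → IncreasingFrom lo t → SplitAt lo t
splitAt [] = skips []
splitAt (lo≤x ∷ t) with m≤n⇒m<n∨m≡n lo≤x
... | inj₁ lo<x = skips (lo<x ∷ t)
... | inj₂ refl = starts t

Recovers : ℕ → ℕ → List ℕ → List ℕ → Set
Recovers lo m t b = positions true lo (indicator t lo m) ≡ t × positions false lo (indicator t lo m) ≡ b

recovers-starts : ∀ t b lo m → Recovers (suc lo) m t b → Recovers lo (suc m) (lo ∷ t) b
recovers-starts t b lo m (r₁ , r₂) =
  subst (λ w → positions true lo w ≡ lo ∷ t × positions false lo w ≡ b) (sym (indicator-starts t lo m)) (cong (lo ∷_) r₁ , r₂)

recovers-skips : ∀ t b lo m → IncreasingFrom (suc lo) t → Recovers (suc lo) m t b → Recovers lo (suc m) t (lo ∷ b)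
recovers-skips t b lo m it (r₁ , r₂) =
  subst (λ w → positions true lo w ≡ t × positions false lo w ≡ lo ∷ b) (sym (indicator-skips t lo m it)) (r₁ , cong (lo ∷_) r₂)

recovers-indicator : ∀ m {lo hi t b} → lo + m ≡ hi → IncreasingFrom lo t → IncreasingFrom lo b →
  All (_< hi) t → All (_< hi) b → Disjoint t b →
  length t + length b ≤ m × (length t + length b ≡ m → Recovers lo m t b)
recovers-indicator zero refl [] [] _ _ _ = z≤n , λ _ → refl , refl
recovers-indicator zero {lo} refl (lo≤x ∷ _) _ (x<lo+0 ∷ _) _ _ = contradiction (subst (_ <_) (+-identityʳ lo) x<lo+0) (≤⇒≯ lo≤x)
recovers-indicator zero {lo} refl [] (lo≤y ∷ _) _ (y<lo+0 ∷ _) _ = contradiction (subst (_ <_) (+-identityʳ lo) y<lo+0) (≤⇒≯ lo≤y)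
recovers-indicator (suc m) {lo} e it ib t<hi b<hi t#b with splitAt it | splitAt ib
... | starts _ | starts _ = contradiction (here refl , here refl) t#b
... | starts {t′} it′ | skips {b} ib′ =
  let bound , recovers = recovers-indicator m e′ it′ ib′ (All.tail t<hi) b<hi (λ (p , q) → t#b (there p , q))
  in s≤s bound , recovers-starts t′ b lo m ∘ recovers ∘ suc-injective
  where e′ = trans (sym (+-suc lo m)) e
... | skips {t} it′ | starts {b′} ib′ =
  let bound , recovers = recovers-indicator m e′ it′ ib′ t<hi (All.tail b<hi) (λ (p , q) → t#b (p , there q))
  in subst (_≤ suc m) (sym (+-suc (length t) (length b′))) (s≤s bound) ,
     recovers-skips t b′ lo m it′ ∘ recovers ∘ suc-injective ∘ trans (sym (+-suc (length t) (length b′)))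
  where e′ = trans (sym (+-suc lo m)) e
... | skips it′ | skips ib′ =
  let bound , _ = recovers-indicator m (trans (sym (+-suc lo m)) e) it′ ib′ t<hi b<hi t#b
  in m≤n⇒m≤1+n bound , λ eq → contradiction (subst (_≤ m) eq bound) (n≮n m)

length-∷ʳ : ∀ {A : Set} (xs : List A) {x} → length (xs ∷ʳ x) ≡ suc (length xs)
length-∷ʳ xs = trans (length-++ xs) (+-comm (length xs) 1)

zipWith-∷ʳ-top : ∀ {k} xs ys → All (_< k) ys →
  zipWith _<ᵇ_ (xs ∷ʳ k) ys ≡ zipWith _<ᵇ_ xs ys ++ (if length xs <ᵇ length ys then [ false ] else [])
zipWith-∷ʳ-top [] [] _ = refl
zipWith-∷ʳ-top {k} [] (y ∷ ys) (y<k ∷ _) = cong (_∷ []) (dec-false (k <? y) (<⇒≯ y<k))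
zipWith-∷ʳ-top (x ∷ xs) [] _ = refl
zipWith-∷ʳ-top (x ∷ xs) (y ∷ ys) (_ ∷ ys<k) = cong ((x <ᵇ y) ∷_) (zipWith-∷ʳ-top xs ys ys<k)

zipWith-∷ʳ-bottom : ∀ {k} xs ys → All (_< k) xs →
  zipWith _<ᵇ_ xs (ys ∷ʳ k) ≡ zipWith _<ᵇ_ xs ys ++ (if length ys <ᵇ length xs then [ true ] else [])
zipWith-∷ʳ-bottom [] [] _ = refl
zipWith-∷ʳ-bottom [] (y ∷ ys) _ = refl
zipWith-∷ʳ-bottom {k} (x ∷ []) [] (x<k ∷ _) = cong (_∷ []) (dec-true (x <? k) x<k)
zipWith-∷ʳ-bottom {k} (x ∷ _ ∷ _) [] (x<k ∷ _) = cong (_∷ []) (dec-true (x <? k) x<k)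
zipWith-∷ʳ-bottom (x ∷ xs) (y ∷ ys) (_ ∷ xs<k) = cong ((x <ᵇ y) ∷_) (zipWith-∷ʳ-bottom xs ys xs<k)

-- Columns are completed from left to right, so columnSigns emits the column
-- comparisons in order.
zipWith-columnSigns : ∀ w {k} xs ys → All (_< k) xs → All (_< k) ys →
  zipWith _<ᵇ_ (xs ++ positions true k w) (ys ++ positions false k w) ≡ zipWith _<ᵇ_ xs ys ++ columnSigns (length xs) (length ys) w
zipWith-columnSigns [] xs ys _ _ = trans (cong₂ (zipWith _<ᵇ_) (++-identityʳ xs) (++-identityʳ ys)) (sym (++-identityʳ _))
zipWith-columnSigns (true ∷ w) {k} xs ys xs<k ys<k = begin
  zipWith _<ᵇ_ (xs ++ k ∷ positions true (suc k) w) (ys ++ positions false (suc k) w)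
    ≡⟨ cong (λ zs → zipWith _<ᵇ_ zs (ys ++ positions false (suc k) w)) (∷ʳ-++ xs k _) ⟨
  zipWith _<ᵇ_ ((xs ∷ʳ k) ++ positions true (suc k) w) (ys ++ positions false (suc k) w)
    ≡⟨ zipWith-columnSigns w (xs ∷ʳ k) ys (∷ʳ⁺ (All.map m<n⇒m<1+n xs<k) ≤-refl) (All.map m<n⇒m<1+n ys<k) ⟩
  zipWith _<ᵇ_ (xs ∷ʳ k) ys ++ columnSigns (length (xs ∷ʳ k)) (length ys) w
    ≡⟨ cong₂ _++_ (zipWith-∷ʳ-top xs ys ys<k) (cong (λ p → columnSigns p (length ys) w) (length-∷ʳ xs)) ⟩
  (zipWith _<ᵇ_ xs ys ++ (if length xs <ᵇ length ys then [ false ] else [])) ++ columnSigns (suc (length xs)) (length ys) w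
    ≡⟨ ++-assoc (zipWith _<ᵇ_ xs ys) _ _ ⟩
  zipWith _<ᵇ_ xs ys ++ ((if length xs <ᵇ length ys then [ false ] else []) ++ columnSigns (suc (length xs)) (length ys) w)
    ≡⟨ cong (zipWith _<ᵇ_ xs ys ++_) (if-float (_++ columnSigns (suc (length xs)) (length ys) w) (length xs <ᵇ length ys)) ⟩
  zipWith _<ᵇ_ xs ys ++ columnSigns (length xs) (length ys) (true ∷ w)
    ∎
zipWith-columnSigns (false ∷ w) {k} xs ys xs<k ys<k = begin
  zipWith _<ᵇ_ (xs ++ positions true (suc k) w) (ys ++ k ∷ positions false (suc k) w)
    ≡⟨ cong (zipWith _<ᵇ_ (xs ++ positions true (suc k) w)) (∷ʳ-++ ys k _) ⟨
  zipWith _<ᵇ_ (xs ++ positions true (suc k) w) ((ys ∷ʳ k) ++ positions false (suc k) w)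
    ≡⟨ zipWith-columnSigns w xs (ys ∷ʳ k) (All.map m<n⇒m<1+n xs<k) (∷ʳ⁺ (All.map m<n⇒m<1+n ys<k) ≤-refl) ⟩
  zipWith _<ᵇ_ xs (ys ∷ʳ k) ++ columnSigns (length xs) (length (ys ∷ʳ k)) w
    ≡⟨ cong₂ _++_ (zipWith-∷ʳ-bottom xs ys xs<k) (cong (λ q → columnSigns (length xs) q w) (length-∷ʳ ys)) ⟩
  (zipWith _<ᵇ_ xs ys ++ (if length ys <ᵇ length xs then [ true ] else [])) ++ columnSigns (length xs) (suc (length ys)) w
    ≡⟨ ++-assoc (zipWith _<ᵇ_ xs ys) _ _ ⟩
  zipWith _<ᵇ_ xs ys ++ ((if length ys <ᵇ length xs then [ true ] else []) ++ columnSigns (length xs) (suc (length ys)) w)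
    ≡⟨ cong (zipWith _<ᵇ_ xs ys ++_) (if-float (_++ columnSigns (length xs) (suc (length ys)) w) (length ys <ᵇ length xs)) ⟩
  zipWith _<ᵇ_ xs ys ++ columnSigns (length xs) (length ys) (false ∷ w)
    ∎

<ᵇ-flip : ∀ {x y} → x ≢ y → (y <ᵇ x) ≡ not (x <ᵇ y)
<ᵇ-flip {x} {y} x≢y with <-cmp x y
... | tri< x<y _ _ = trans (dec-false (y <? x) (<⇒≯ x<y)) (cong not (sym (dec-true (x <? y) x<y)))
... | tri≈ _ x≡y _ = contradiction x≡y x≢y
... | tri> _ _ y<x = trans (dec-true (y <? x) y<x) (cong not (sym (dec-false (x <? y) (<⇒≯ y<x))))

inversionsRows-∷ : ∀ {x y xs ys} → x ≢ y → Pointwise _≢_ xs ys →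
  inversionsRows (x ∷ xs) (y ∷ ys) ≡ signChanges (just (x <ᵇ y)) (zipWith _<ᵇ_ xs ys)
inversionsRows-∷ {x} {y} x≢y [] rewrite <ᵇ-flip x≢y with x <ᵇ y
... | true = refl
... | false = refl
inversionsRows-∷ {x} {y} {x′ ∷ _} {y′ ∷ _} x≢y (x′≢y′ ∷ rest) rewrite <ᵇ-flip x≢y | <ᵇ-flip x′≢y′ =
  cong₂ _+_ (changed-columns (x <ᵇ y) (x′ <ᵇ y′)) (inversionsRows-∷ x′≢y′ rest)
  where
  changed-columns : ∀ s s′ → b2n ((s ∧ not s′) ∨ (not s ∧ s′)) ≡ changed (just s) s′
  changed-columns true true = refl
  changed-columns true false = refl
  changed-columns false true = refl
  changed-columns false false = refl

inversionsRows-signChanges : ∀ {xs ys} → Pointwise _≢_ xs ys → inversionsRows xs ys ≡ signChanges nothing (zipWith _<ᵇ_ xs ys)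
inversionsRows-signChanges [] = refl
inversionsRows-signChanges (x≢y ∷ rest) = inversionsRows-∷ x≢y rest

n+n≡2*n : ∀ n → n + n ≡ 2 * n
n+n≡2*n n = cong (n +_) (sym (+-identityʳ n))

Disjoint⇒Pointwise≢ : ∀ {xs ys : List ℕ} → length xs ≡ length ys → Disjoint xs ys → Pointwise _≢_ xs ys
Disjoint⇒Pointwise≢ {[]} {[]} _ _ = []
Disjoint⇒Pointwise≢ {x ∷ xs} {y ∷ ys} e xs#ys =
  (λ x≡y → xs#ys (here refl , here x≡y)) ∷ Disjoint⇒Pointwise≢ (suc-injective e) (λ (p , q) → xs#ys (there p , there q))

wordInversions : List Bool → ℕ
wordInversions w = signChanges nothing (columnSigns 0 0 w)

inversionsRows-positions : ∀ w → length (positions true 0 w) ≡ length (positions false 0 w) →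
  inversionsRows (positions true 0 w) (positions false 0 w) ≡ wordInversions w
inversionsRows-positions w e =
  trans (inversionsRows-signChanges (Disjoint⇒Pointwise≢ e (positions-disjoint 0 w)))
        (cong (signChanges nothing) (zipWith-columnSigns w [] [] [] []))

wordsWith-sound : ∀ a b {w} → w ∈ wordsWith a b → ∀ k → length (positions true k w) ≡ a × length (positions false k w) ≡ b
wordsWith-sound zero zero (here refl) k = refl , refl
wordsWith-sound zero (suc b) w∈ k with ∈-map⁻ (false ∷_) w∈
... | _ , w∈′ , refl = map₂ (cong suc) (wordsWith-sound zero b w∈′ (suc k))
wordsWith-sound (suc a) zero w∈ k with ∈-map⁻ (true ∷_) w∈
... | _ , w∈′ , refl = map₁ (cong suc) (wordsWith-sound a zero w∈′ (suc k))
wordsWith-sound (suc a) (suc b) w∈ k with ∈-++⁻ (map (true ∷_) (wordsWith a (suc b))) w∈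
... | inj₁ w∈ᵗ with ∈-map⁻ (true ∷_) w∈ᵗ
...   | _ , w∈′ , refl = map₁ (cong suc) (wordsWith-sound a (suc b) w∈′ (suc k))
wordsWith-sound (suc a) (suc b) w∈ k | inj₂ w∈ᶠ with ∈-map⁻ (false ∷_) w∈ᶠ
...   | _ , w∈′ , refl = map₂ (cong suc) (wordsWith-sound (suc a) b w∈′ (suc k))

wordsWith-complete : ∀ k w → w ∈ wordsWith (length (positions true k w)) (length (positions false k w))
wordsWith-complete k [] = here refl
wordsWith-complete k (true ∷ w) with length (positions false (suc k) w) | wordsWith-complete (suc k) w
... | zero | w∈ = ∈-map⁺ (true ∷_) w∈
... | suc b | w∈ = ∈-++⁺ˡ (∈-map⁺ (true ∷_) w∈)
wordsWith-complete k (false ∷ w) with length (positions true (suc k) w) | wordsWith-complete (suc k) w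
... | zero | w∈ = ∈-map⁺ (false ∷_) w∈
... | suc a | w∈ = ∈-++⁺ʳ (map (true ∷_) (wordsWith a (suc _))) (∈-map⁺ (false ∷_) w∈)

wordsWith-unique : ∀ a b → Unique (wordsWith a b)
wordsWith-unique zero zero = [] ∷ []
wordsWith-unique zero (suc b) = Unique.map⁺ ∷-injectiveʳ (wordsWith-unique zero b)
wordsWith-unique (suc a) zero = Unique.map⁺ ∷-injectiveʳ (wordsWith-unique a zero)
wordsWith-unique (suc a) (suc b) =
  Unique.++⁺ (Unique.map⁺ ∷-injectiveʳ (wordsWith-unique a (suc b))) (Unique.map⁺ ∷-injectiveʳ (wordsWith-unique (suc a) b)) first-letters
  where
  first-letters : Disjoint (map (true ∷_) (wordsWith a (suc b))) (map (false ∷_) (wordsWith (suc a) b))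
  first-letters (w∈ᵗ , w∈ᶠ) with ∈-map⁻ (true ∷_) w∈ᵗ | ∈-map⁻ (false ∷_) w∈ᶠ
  ... | _ , _ , refl | _ , _ , ()

row : ∀ {m n} → Vec (Fin m) n → List ℕ
row v = map toℕ (toList v)

length-row : ∀ {m n} (v : Vec (Fin m) n) → length (row v) ≡ n
length-row v = trans (length-map toℕ (toList v)) (length-toList v)

row-< : ∀ {m n} (v : Vec (Fin m) n) → All (_< m) (row v)
row-< V.[] = []
row-< (x V.∷ v) = toℕ<n x ∷ row-< v

row-injective : ∀ {m n} {u v : Vec (Fin m) n} → row u ≡ row v → u ≡ v
row-injective {u = u} {v} e = trans (sym (cast-is-id refl u)) (toList-injective refl u v (map-injective toℕ-injective e))

fromRow : ∀ {m} n (xs : List ℕ) → length xs ≡ n → All (_< m) xs → Vec (Fin m) n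
fromRow zero [] _ [] = V.[]
fromRow (suc n) (x ∷ xs) e (x<m ∷ xs<m) = fromℕ< x<m V.∷ fromRow n xs (suc-injective e) xs<m

row-fromRow : ∀ {m} n xs e (xs<m : All (_< m) xs) → row (fromRow n xs e xs<m) ≡ xs
row-fromRow zero [] _ [] = refl
row-fromRow (suc n) (x ∷ xs) e (x<m ∷ xs<m) = cong₂ _∷_ (toℕ-fromℕ< x<m) (row-fromRow n xs (suc-injective e) xs<m)

record RowStandard {n} (τ : Tableau n) : Set where
  field
    top-increasing : IncreasingFrom 0 (topℕ τ)
    bottom-increasing : IncreasingFrom 0 (bottomℕ τ)
    rows-disjoint : Disjoint (topℕ τ) (bottomℕ τ)
open RowStandard

T-increasing : ∀ xs → T (increasing xs) ⇔ IncreasingFrom 0 xs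
T-increasing [] = mk⇔ (λ _ → []) _
T-increasing (x ∷ xs) = mk⇔ (from-increasing z≤n) (to-increasing)
  where
  from-increasing : ∀ {lo x xs} → lo ≤ x → T (increasing (x ∷ xs)) → IncreasingFrom lo (x ∷ xs)
  from-increasing {xs = []} lo≤x _ = lo≤x ∷ []
  from-increasing {x = x} {y ∷ xs} lo≤x inc =
    let x<y , inc′ = Equivalence.to T-∧ inc in lo≤x ∷ from-increasing (<ᵇ⇒< x y x<y) inc′
  to-increasing : ∀ {lo x xs} → IncreasingFrom lo (x ∷ xs) → T (increasing (x ∷ xs))
  to-increasing (_ ∷ []) = _
  to-increasing (_ ∷ (x<y ∷ ys)) = Equivalence.from T-∧ (<⇒<ᵇ x<y , to-increasing (x<y ∷ ys))

T-not-any-≡ᵇ : ∀ x xs → T (not (any (x ≡ᵇ_) xs)) ⇔ All (x ≢_) xs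
T-not-any-≡ᵇ x [] = mk⇔ (λ _ → []) _
T-not-any-≡ᵇ x (y ∷ ys) with x ≡ᵇ y in eq
... | true = mk⇔ (λ ()) (λ { (x≢y ∷ _) → contradiction (≡ᵇ⇒≡ x y (subst T (sym eq) _)) x≢y })
... | false = mk⇔ (λ t → x≢y ∷ Equivalence.to (T-not-any-≡ᵇ x ys) t) (λ { (_ ∷ a) → Equivalence.from (T-not-any-≡ᵇ x ys) a })
  where
  x≢y : x ≢ y
  x≢y x≡y = subst T eq (≡⇒≡ᵇ x y x≡y)

T-distinct : ∀ xs → T (distinct xs) ⇔ Unique xs
T-distinct [] = mk⇔ (λ _ → []) _
T-distinct (x ∷ xs) = mk⇔
  (λ t → let h , r = Equivalence.to T-∧ t in Equivalence.to (T-not-any-≡ᵇ x xs) h ∷ Equivalence.to (T-distinct xs) r)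
  (λ { (h ∷ r) → Equivalence.from T-∧ (Equivalence.from (T-not-any-≡ᵇ x xs) h , Equivalence.from (T-distinct xs) r) })

IncreasingFrom⇒Unique : ∀ {lo xs} → IncreasingFrom lo xs → Unique xs
IncreasingFrom⇒Unique [] = []
IncreasingFrom⇒Unique (_ ∷ xs) = All.map <⇒≢ (IncreasingFrom⇒All≤ xs) ∷ IncreasingFrom⇒Unique xs

Unique-++⇒Disjoint : ∀ {A : Set} (xs : List A) {ys} → Unique (xs ++ ys) → Disjoint xs ys
Unique-++⇒Disjoint (x ∷ xs) (x∉ ∷ _) (here refl , x∈ys) = All.lookup x∉ (∈-++⁺ʳ xs x∈ys) refl
Unique-++⇒Disjoint (x ∷ xs) (_ ∷ u) (there v∈xs , v∈ys) = Unique-++⇒Disjoint xs u (v∈xs , v∈ys)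

T-isRowStandardTableau : ∀ {n} (τ : Tableau n) → T (isRowStandardTableau τ) ⇔ RowStandard τ
T-isRowStandardTableau τ = mk⇔ to from
  where
  t = topℕ τ
  b = bottomℕ τ
  to : T (isRowStandardTableau τ) → RowStandard τ
  to rs = let d , i = Equivalence.to T-∧ rs ; it , ib = Equivalence.to T-∧ i in record
    { top-increasing = Equivalence.to (T-increasing t) it
    ; bottom-increasing = Equivalence.to (T-increasing b) ib
    ; rows-disjoint = Unique-++⇒Disjoint t (Equivalence.to (T-distinct (t ++ b)) d) }
  from : RowStandard τ → T (isRowStandardTableau τ)
  from rs = Equivalence.from T-∧
    ( Equivalence.from (T-distinct (t ++ b))
        (Unique.++⁺ (IncreasingFrom⇒Unique (top-increasing rs)) (IncreasingFrom⇒Unique (bottom-increasing rs)) (rows-disjoint rs))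
    , Equivalence.from T-∧ (Equivalence.from (T-increasing t) (top-increasing rs) , Equivalence.from (T-increasing b) (bottom-increasing rs)) )

wordOf : ∀ {n} → Tableau n → List Bool
wordOf {n} τ = indicator (topℕ τ) 0 (2 * n)

module _ {n} {τ : Tableau n} (rs : RowStandard τ) where

  positions-wordOf : Recovers 0 (2 * n) (topℕ τ) (bottomℕ τ)
  positions-wordOf =
    proj₂ (recovers-indicator (2 * n) refl (top-increasing rs) (bottom-increasing rs) (row-< (top τ)) (row-< (bottom τ)) (rows-disjoint rs))
          (trans (cong₂ _+_ (length-row (top τ)) (length-row (bottom τ))) (n+n≡2*n n))

  length-positions-wordOf : length (positions true 0 (wordOf τ)) ≡ n × length (positions false 0 (wordOf τ)) ≡ n
  length-positions-wordOf = trans (cong length (proj₁ positions-wordOf)) (length-row (top τ))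
                          , trans (cong length (proj₂ positions-wordOf)) (length-row (bottom τ))

  wordOf-∈ : wordOf τ ∈ wordsWith n n
  wordOf-∈ = subst₂ (λ a b → wordOf τ ∈ wordsWith a b) (proj₁ length-positions-wordOf) (proj₂ length-positions-wordOf)
                    (wordsWith-complete 0 (wordOf τ))

  inversions-wordOf : inversions τ ≡ wordInversions (wordOf τ)
  inversions-wordOf = begin
    inversionsRows (topℕ τ) (bottomℕ τ)
      ≡⟨ cong₂ inversionsRows (proj₁ positions-wordOf) (proj₂ positions-wordOf) ⟨
    inversionsRows (positions true 0 (wordOf τ)) (positions false 0 (wordOf τ))
      ≡⟨ inversionsRows-positions (wordOf τ) (trans (proj₁ length-positions-wordOf) (sym (proj₂ length-positions-wordOf))) ⟩
    wordInversions (wordOf τ) ∎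

wordOf-injective : ∀ {n} {τ τ′ : Tableau n} → RowStandard τ → RowStandard τ′ → wordOf τ ≡ wordOf τ′ → τ ≡ τ′
wordOf-injective {τ = tab t b} {tab t′ b′} rs rs′ e = cong₂ tab
  (row-injective (trans (sym (proj₁ (positions-wordOf rs))) (trans (cong (positions true 0) e) (proj₁ (positions-wordOf rs′)))))
  (row-injective (trans (sym (proj₂ (positions-wordOf rs))) (trans (cong (positions false 0) e) (proj₂ (positions-wordOf rs′)))))

module _ (n : ℕ) {w} (w∈ : w ∈ wordsWith n n) where

  private
    lengths = wordsWith-sound n n w∈ 0

    length-w : length w ≡ 2 * n
    length-w = trans (length-positions 0 w) (trans (cong₂ _+_ (proj₁ lengths) (proj₂ lengths)) (n+n≡2*n n))

    positions-<2n : ∀ c → All (_< 2 * n) (positions c 0 w)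
    positions-<2n c = subst (λ h → All (_< h) (positions c 0 w)) length-w (positions-< c 0 w)

  tableauOf : Tableau n
  tableauOf = tab (fromRow n (positions true 0 w) (proj₁ lengths) (positions-<2n true))
                  (fromRow n (positions false 0 w) (proj₂ lengths) (positions-<2n false))

  top-tableauOf : topℕ tableauOf ≡ positions true 0 w
  top-tableauOf = row-fromRow n (positions true 0 w) (proj₁ lengths) (positions-<2n true)

  bottom-tableauOf : bottomℕ tableauOf ≡ positions false 0 w
  bottom-tableauOf = row-fromRow n (positions false 0 w) (proj₂ lengths) (positions-<2n false)

  tableauOf-rowStandard : RowStandard tableauOf
  tableauOf-rowStandard = record
    { top-increasing = subst (IncreasingFrom 0) (sym top-tableauOf) (positions-increasing true 0 w)
    ; bottom-increasing = subst (IncreasingFrom 0) (sym bottom-tableauOf) (positions-increasing false 0 w)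
    ; rows-disjoint = subst₂ Disjoint (sym top-tableauOf) (sym bottom-tableauOf) (positions-disjoint 0 w) }

  wordOf-tableauOf : wordOf tableauOf ≡ w
  wordOf-tableauOf = begin
    indicator (topℕ tableauOf) 0 (2 * n)        ≡⟨ cong₂ (λ t m → indicator t 0 m) top-tableauOf (sym length-w) ⟩
    indicator (positions true 0 w) 0 (length w) ≡⟨ indicator-positions 0 w ⟩
    w ∎

concatMap-map : ∀ {A B C : Set} (f : A → B → C) xs ys → concatMap (λ x → map (f x) ys) xs ≡ cartesianProductWith f xs ys
concatMap-map f [] ys = refl
concatMap-map f (x ∷ xs) ys = cong (map (f x) ys ++_) (concatMap-map f xs ys)

allVecs-unique : ∀ k m → Unique (allVecs k m)
allVecs-unique zero m = [] ∷ []
allVecs-unique (suc k) m = subst Unique (sym (concatMap-map V._∷_ (allFin m) (allVecs k m)))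
  (Unique.cartesianProductWith⁺ V._∷_ ∷-injective (Unique.allFin⁺ m) (allVecs-unique k m))

allVecs-complete : ∀ {k m} (v : Vec (Fin m) k) → v ∈ allVecs k m
allVecs-complete V.[] = here refl
allVecs-complete {suc k} {m} (x V.∷ v) = subst (x V.∷ v ∈_) (sym (concatMap-map V._∷_ (allFin m) (allVecs k m)))
  (∈-cartesianProductWith⁺ V._∷_ (∈-allFin x) (allVecs-complete v))

tab-injective : ∀ {n} {t t′ b b′ : Vec (Fin (2 * n)) n} → tab t b ≡ tab t′ b′ → t ≡ t′ × b ≡ b′
tab-injective refl = refl , refl

allFillings-unique : ∀ n → Unique (allFillings n)
allFillings-unique n = subst Unique (sym (concatMap-map tab (allVecs n (2 * n)) (allVecs n (2 * n))))
  (Unique.cartesianProductWith⁺ tab tab-injective (allVecs-unique n (2 * n)) (allVecs-unique n (2 * n)))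

allFillings-complete : ∀ {n} (τ : Tableau n) → τ ∈ allFillings n
allFillings-complete {n} (tab t b) = subst (tab t b ∈_) (sym (concatMap-map tab (allVecs n (2 * n)) (allVecs n (2 * n))))
  (∈-cartesianProductWith⁺ tab (allVecs-complete t) (allVecs-complete b))

Unique-map : ∀ {A B : Set} (f : A → B) {xs} → Unique xs →
  (∀ {x x′} → x ∈ xs → x′ ∈ xs → f x ≡ f x′ → x ≡ x′) → Unique (map f xs)
Unique-map f [] _ = []
Unique-map f (x∉ ∷ u) inj =
  map⁺ (All.tabulate (λ x′∈ fx≡fx′ → All.lookup x∉ x′∈ (inj (here refl) (there x′∈) fx≡fx′)))
  ∷ Unique-map f u (λ p q → inj (there p) (there q))

length-≡-by-bijection : ∀ {A B : Set} (f : A → B) {xs : List A} {ys : List B} → Unique xs → Unique ys →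
  (∀ {x x′} → x ∈ xs → x′ ∈ xs → f x ≡ f x′ → x ≡ x′) → (∀ {x} → x ∈ xs → f x ∈ ys) →
  (∀ {y} → y ∈ ys → ∃ λ x → x ∈ xs × y ≡ f x) → length xs ≡ length ys
length-≡-by-bijection f {xs} {ys} ux uy inj into onto = begin
  length xs          ≡⟨ length-map f xs ⟨
  length (map f xs)  ≡⟨ ↭-length (∼bag⇒↭ (unique∧set⇒bag (Unique-map f ux inj) uy (mk⇔ ⊆ys ys⊆))) ⟩
  length ys          ∎
  where
  ⊆ys : ∀ {y} → y ∈ map f xs → y ∈ ys
  ⊆ys y∈ with ∈-map⁻ f y∈
  ... | x , x∈ , refl = into x∈
  ys⊆ : ∀ {y} → y ∈ ys → y ∈ map f xs
  ys⊆ y∈ with onto y∈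
  ... | x , x∈ , refl = ∈-map⁺ f x∈

S-card≡signCount : ∀ i n → S-card i n ≡ signCount 0 0 nothing (wordsWith n n) i
S-card≡signCount i n = length-≡-by-bijection wordOf
  (Unique.filter⁺ (T? ∘ P) (allFillings-unique n))
  (Unique.filter⁺ (T? ∘ Q) (wordsWith-unique n n))
  (λ τ∈ τ′∈ → wordOf-injective (proj₁ (member τ∈)) (proj₁ (member τ′∈)))
  into onto
  where
  P : Tableau n → Bool
  P τ = isRowStandardTableau τ ∧ (inversions τ ≡ᵇ i)
  Q : List Bool → Bool
  Q w = wordInversions w ≡ᵇ i
  member : ∀ {τ} → τ ∈ filterᵇ P (allFillings n) → RowStandard τ × T (inversions τ ≡ᵇ i)
  member τ∈ = map₁ (Equivalence.to (T-isRowStandardTableau _)) (Equivalence.to T-∧ (proj₂ (∈-filter⁻ (T? ∘ P) {xs = allFillings n} τ∈)))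
  into : ∀ {τ} → τ ∈ filterᵇ P (allFillings n) → wordOf τ ∈ filterᵇ Q (wordsWith n n)
  into τ∈ = let rs , inversions≡i = member τ∈ in
    ∈-filter⁺ (T? ∘ Q) (wordOf-∈ rs) (subst (λ k → T (k ≡ᵇ i)) (inversions-wordOf rs) inversions≡i)
  onto : ∀ {w} → w ∈ filterᵇ Q (wordsWith n n) → ∃ λ τ → τ ∈ filterᵇ P (allFillings n) × w ≡ wordOf τ
  onto {w} w∈ = tableauOf n w∈ₙ , ∈-filter⁺ (T? ∘ P) (allFillings-complete (tableauOf n w∈ₙ)) Pτ , sym (wordOf-tableauOf n w∈ₙ)
    where
    w∈ₙ : w ∈ wordsWith n n
    w∈ₙ = proj₁ (∈-filter⁻ (T? ∘ Q) {xs = wordsWith n n} w∈)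
    rs = tableauOf-rowStandard n w∈ₙ
    inversions≡ : inversions (tableauOf n w∈ₙ) ≡ wordInversions w
    inversions≡ = trans (inversions-wordOf rs) (cong wordInversions (wordOf-tableauOf n w∈ₙ))
    Pτ : T (P (tableauOf n w∈ₙ))
    Pτ = Equivalence.from T-∧ ( Equivalence.from (T-isRowStandardTableau _) rs
                              , subst (λ k → T (k ≡ᵇ i)) (sym inversions≡) (proj₂ (∈-filter⁻ (T? ∘ Q) {xs = wordsWith n n} w∈)) )


theorem2p3 : (n : ℕ) → 1 ≤ n → (i : ℕ) →
    S-card i n ≡ catalanCompSum i n + catalanCompSum (suc i) n
theorem2p3 n _ i = begin
  S-card i n                                    ≡⟨ S-card≡signCount i n ⟩
  signCount 0 0 nothing (wordsWith n n) i       ≡⟨ signCount-balanced n i ⟩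
  raisedBallot 0 n i                            ≡⟨ catalanCompSum-pair i n ⟨
  catalanCompSum i n + catalanCompSum (suc i) n ∎
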